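{- Let $G$ be a graph, $v\in V(G)$ and $G'=G-v$. Then $\gamma_{\rm gr}^t(G)-2\le\gamma_{\rm gr}^t(G')\le\gamma_{\rm gr}^t(G)$.
   Context: All graphs are finite and simple; $G-v$ is the subgraph induced by $V(G)\setminus\{v\}$. For a vertex $x$, $N(x)$ is its open neighborhood. A sequence $(v_1,\ldots,v_k)$ of distinct vertices is legal if for every $i\in\{1,\ldots,k\}$, $N(v_i)\setminus\bigcup_{j=1}^{i-1}N(v_j)\neq\emptyset$ (the empty sequence is legal). $\gamma_{\rm gr}^t(G)$ is the maximum length of a legal sequence of $G$ (this is defined also for graphs with isolated vertices, and equals $0$ for graphs without edges). -}

module Defs where

open import Data.Nat using (ℕ; suc; _<_)
open import Data.Bool using (Bool; true; false)
open import Data.Fin using (Fin; toℕ; punchIn)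
open import Data.List using (List; length; lookup)
open import Data.List.Relation.Unary.Unique.Propositional using (Unique)
open import Data.Product using (_×_; ∃)
open import Relation.Binary.PropositionalEquality using (_≡_; cong₂)

record Graph (n : ℕ) : Set where
  field
    adj    : Fin n → Fin n → Bool
    sym    : ∀ x y → adj x y ≡ adj y x
    irrefl : ∀ x → adj x x ≡ false
open Graph public

-- G - v : the subgraph induced by V(G) \ {v}; vertices of G - v are
-- identified with Fin n via punchIn v (order-preserving relabelling).
delete : ∀ {n} → Graph (suc n) → Fin (suc n) → Graph n
delete G v = record
  { adj    = λ x y → adj G (punchIn v x) (punchIn v y)
  ; sym    = λ x y → sym G (punchIn v x) (punchIn v y)
  ; irrefl = λ x → irrefl G (punchIn v x)
  }

_∈N[_]_ : ∀ {n} → Fin n → Graph n → Fin n → Set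
u ∈N[ G ] x = adj G x u ≡ true

Legal : ∀ {n} → Graph n → List (Fin n) → Set
Legal G xs = Unique xs ×
  (∀ (i : Fin (length xs)) → ∃ λ u → (u ∈N[ G ] lookup xs i) ×
     (∀ (j : Fin (length xs)) → toℕ j < toℕ i → adj G (lookup xs j) u ≡ false))

IsTGrundy : ∀ {n} → Graph n → ℕ → Set
IsTGrundy G k = (∃ λ xs → Legal G xs × length xs ≡ k) ×
                (∀ xs → Legal G xs → length xs Data.Nat.≤ k)

-- Reading a legal sequence as a list in which every vertex dominates a vertex
-- not yet dominated, deleting v from G leaves the legal sequences of G − v
-- legal in G, so γ(G − v) ≤ γ(G). Conversely, from a legal sequence of G drop
-- v itself and the (unique) entry whose newly dominated vertex is v: every
-- earlier entry dominates a new vertex other than v because it is not adjacent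
-- to v, every later one because v is already dominated. What remains is legal
-- in G − v and at most two entries shorter.
module Submission where

open import Defs hiding (sym)
open import Data.Nat using (ℕ; suc; zero; _+_; _≤_; _<_; z≤n; s≤s)
open import Data.Nat.Properties using (+-suc; +-assoc; ≤-trans; ≤-reflexive; +-monoˡ-≤)
open import Data.Fin using (Fin; toℕ; punchIn; punchOut) renaming (zero to fzero; suc to fsuc)
open import Data.Fin.Properties using (punchIn-punchOut; _≟_)
open import Data.Bool using (false)
open import Data.List using (List; []; _∷_; length; lookup; map)
open import Data.List.Properties using (length-map)
open import Data.List.Relation.Unary.All as All using (All; []; _∷_)
open import Data.List.Relation.Unary.All.Properties using (map⁺)
open import Data.List.Relation.Unary.Any using (Any; here; there)
open import Data.List.Membership.Propositional using (_∈_; _∉_)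
open import Data.List.Relation.Unary.Unique.Propositional using (Unique)
open import Data.List.Relation.Unary.AllPairs using ([]; _∷_)
open import Data.Product using (_×_; _,_; ∃-syntax)
open import Data.Empty using (⊥; ⊥-elim)
open import Data.Unit using (⊤; tt)
open import Function using (_∘_)
open import Relation.Nullary using (yes; no)
open import Relation.Binary.PropositionalEquality

module _ {n : ℕ} (G : Graph n) where

  Dominated : List (Fin n) → Fin n → Set
  Dominated pre u = Any (λ y → u ∈N[ G ] y) pre

  Undominated : List (Fin n) → Fin n → Set
  Undominated pre u = All (λ y → adj G y u ≡ false) pre

  undominated⇒¬dominated : ∀ {pre u} → Undominated pre u → Dominated pre u → ⊥
  undominated⇒¬dominated (y≁u ∷ _) (here y~u) with trans (sym y≁u) y~u
  ... | ()
  undominated⇒¬dominated (_ ∷ undom) (there dom) = undominated⇒¬dominated undom dom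

  DominatesNew : List (Fin n) → Fin n → Set
  DominatesNew pre x = ∃[ u ] u ∈N[ G ] x × Undominated pre u

  -- The prefix is kept in reverse order; only its members matter.
  LegalAfter : List (Fin n) → List (Fin n) → Set
  LegalAfter pre []       = ⊤
  LegalAfter pre (x ∷ xs) = DominatesNew pre x × LegalAfter (x ∷ pre) xs

  LegalAfterByIndex : List (Fin n) → List (Fin n) → Set
  LegalAfterByIndex pre xs = ∀ (i : Fin (length xs)) → ∃[ u ] u ∈N[ G ] lookup xs i ×
    Undominated pre u × (∀ (j : Fin (length xs)) → toℕ j < toℕ i → adj G (lookup xs j) u ≡ false)

  byIndex⇒legalAfter : ∀ pre xs → LegalAfterByIndex pre xs → LegalAfter pre xs
  byIndex⇒legalAfter pre []       _     = tt
  byIndex⇒legalAfter pre (x ∷ xs) legal =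
    (let (u , x~u , undom , _) = legal fzero in u , x~u , undom) ,
    byIndex⇒legalAfter (x ∷ pre) xs tailLegal
    where
    tailLegal : LegalAfterByIndex (x ∷ pre) xs
    tailLegal i with legal (fsuc i)
    ... | u , y~u , undom , earlier =
      u , y~u , earlier fzero (s≤s z≤n) ∷ undom , λ j j<i → earlier (fsuc j) (s≤s j<i)

  legalAfter⇒byIndex : ∀ pre xs → LegalAfter pre xs → LegalAfterByIndex pre xs
  legalAfter⇒byIndex pre (x ∷ xs) ((u , x~u , undom) , _) fzero = u , x~u , undom , λ _ ()
  legalAfter⇒byIndex pre (x ∷ xs) (_ , rest) (fsuc i)
    with legalAfter⇒byIndex (x ∷ pre) xs rest i
  ... | u , y~u , x≁u ∷ undom , earlier = u , y~u , undom , earlier′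
    where
    earlier′ : ∀ j → toℕ j < toℕ {suc (length xs)} (fsuc i) → adj G (lookup (x ∷ xs) j) u ≡ false
    earlier′ fzero    _         = x≁u
    earlier′ (fsuc j) (s≤s j<i) = earlier j j<i

  -- An entry is a neighbour of its own new vertex, so it cannot already be in the prefix.
  legalAfter-disjoint : ∀ {pre} xs → LegalAfter pre xs → ∀ {y} → y ∈ pre → y ∉ xs
  legalAfter-disjoint (x ∷ xs) ((u , x~u , undom) , _) x∈pre (here refl)
    with trans (sym x~u) (All.lookup undom x∈pre)
  ... | ()
  legalAfter-disjoint (x ∷ xs) (_ , rest) y∈pre (there y∈xs) =
    legalAfter-disjoint xs rest (there y∈pre) y∈xs

  legalAfter⇒unique : ∀ {pre} xs → LegalAfter pre xs → Unique xs
  legalAfter⇒unique []       _           = []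
  legalAfter⇒unique (x ∷ xs) (_ , rest) =
    All.tabulate (λ {y} y∈xs x≡y → legalAfter-disjoint xs rest (here (sym x≡y)) y∈xs)
    ∷ legalAfter⇒unique xs rest

  legal⇒legalAfter : ∀ xs → Legal G xs → LegalAfter [] xs
  legal⇒legalAfter xs (_ , legal) =
    byIndex⇒legalAfter [] xs (λ i → let (u , x~u , earlier) = legal i in u , x~u , [] , earlier)

  legalAfter⇒legal : ∀ xs → LegalAfter [] xs → Legal G xs
  legalAfter⇒legal xs legal =
    legalAfter⇒unique xs legal ,
    λ i → let (u , x~u , _ , earlier) = legalAfter⇒byIndex [] xs legal i in u , x~u , earlier

module _ {n : ℕ} (G : Graph (suc n)) (v : Fin (suc n)) where

  private
    H : Graph n
    H = delete G v

  legalAfter-punchIn : ∀ pre xs → LegalAfter H pre xs →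
                       LegalAfter G (map (punchIn v) pre) (map (punchIn v) xs)
  legalAfter-punchIn pre []       _                             = tt
  legalAfter-punchIn pre (x ∷ xs) ((u , x~u , undom) , rest) =
    (punchIn v u , x~u , map⁺ undom) , legalAfter-punchIn (x ∷ pre) xs rest

  legal-punchIn : ∀ xs → Legal H xs → Legal G (map (punchIn v) xs)
  legal-punchIn xs = legalAfter⇒legal G _ ∘ legalAfter-punchIn [] xs ∘ legal⇒legalAfter H xs

  Covers : List (Fin n) → List (Fin (suc n)) → Set
  Covers pre′ pre = ∀ {y} → y ∈ pre′ → punchIn v y ∈ pre

  dominatesNew-punchOut : ∀ {pre pre′ x u} (v≢x : v ≢ x) (v≢u : v ≢ u) → Covers pre′ pre →
                          u ∈N[ G ] x → Undominated G pre u → DominatesNew H pre′ (punchOut v≢x)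
  dominatesNew-punchOut v≢x v≢u cov x~u undom =
    punchOut v≢u ,
    subst₂ (λ x u → adj G x u ≡ _) (sym (punchIn-punchOut v≢x)) (sym (punchIn-punchOut v≢u)) x~u ,
    All.tabulate (λ y∈ → subst (λ u → adj G _ u ≡ false) (sym (punchIn-punchOut v≢u))
                                 (All.lookup undom (cov y∈)))

  -- The budget a pays for deleting v as an entry, b for deleting the entry whose
  -- new vertex is v; each is needed only while its event can still happen.
  restrictAfter : ∀ {pre pre′} → Covers pre′ pre → ∀ xs → LegalAfter G pre xs →
                  (a b : ℕ) → (a ≡ 0 → v ∉ xs) → (b ≡ 0 → Dominated G pre v) →
                  ∃[ ys ] LegalAfter H pre′ ys × length xs ≤ length ys + a + b
  restrictAfter cov [] _ a b _ _ = [] , tt , z≤n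
  restrictAfter cov (x ∷ xs) ((u , x~u , undom) , rest) a b v∉ v-dom with v ≟ x | v ≟ u
  restrictAfter cov (x ∷ xs) _ zero b v∉ v-dom | yes v≡x | _ = ⊥-elim (v∉ refl (here v≡x))
  restrictAfter cov (x ∷ xs) (_ , rest) (suc a) b v∉ v-dom | yes v≡x | _
    with restrictAfter (there ∘ cov) xs rest a b
           (λ _ → legalAfter-disjoint G xs rest (here v≡x)) (there ∘ v-dom)
  ... | ys , legal , len = ys , legal , ≤-trans (s≤s len) (≤-reflexive (cong (_+ b) (sym (+-suc _ a))))
  restrictAfter cov (x ∷ xs) ((u , _ , undom) , _) a zero v∉ v-dom | no _ | yes v≡u =
    ⊥-elim (undominated⇒¬dominated G undom (subst (Dominated G _) v≡u (v-dom refl)))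
  restrictAfter cov (x ∷ xs) ((u , x~u , _) , rest) a (suc b) v∉ v-dom | no _ | yes v≡u
    with restrictAfter (there ∘ cov) xs rest a b
           (λ a≡0 → v∉ a≡0 ∘ there) (λ _ → here (subst (_∈N[ G ] x) (sym v≡u) x~u))
  ... | ys , legal , len = ys , legal , ≤-trans (s≤s len) (≤-reflexive (sym (+-suc _ b)))
  restrictAfter {pre} {pre′} cov (x ∷ xs) ((u , x~u , undom) , rest) a b v∉ v-dom | no v≢x | no v≢u
    with restrictAfter cov′ xs rest a b (λ a≡0 → v∉ a≡0 ∘ there) (there ∘ v-dom)
    where
    cov′ : Covers (punchOut v≢x ∷ pre′) (x ∷ pre)
    cov′ (here refl) = here (punchIn-punchOut v≢x)
    cov′ (there y∈)  = there (cov y∈)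
  ... | ys , legal , len =
    punchOut v≢x ∷ ys , (dominatesNew-punchOut v≢x v≢u cov x~u undom , legal) , s≤s len

  legal-restrict : ∀ xs → Legal G xs → ∃[ ys ] Legal H ys × length xs ≤ length ys + 2
  legal-restrict xs legal
    with restrictAfter (λ ()) xs (legal⇒legalAfter G xs legal) 1 1 (λ ()) (λ ())
  ... | ys , legal′ , len =
    ys , legalAfter⇒legal H ys legal′ , ≤-trans len (≤-reflexive (+-assoc (length ys) 1 1))

lemma3p5 : ∀ {n} (G : Graph (suc n)) (v : Fin (suc n)) (k k′ : ℕ) →
    IsTGrundy G k → IsTGrundy (delete G v) k′ →
    k ≤ k′ + 2 × k′ ≤ k
lemma3p5 G v k k′ ((xs , legal , refl) , maxG) ((ys , legal′ , refl) , maxH) =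
  upper , lower
  where
  upper : length xs ≤ length ys + 2
  upper with legal-restrict G v xs legal
  ... | zs , legalZs , len = ≤-trans len (+-monoˡ-≤ 2 (maxH zs legalZs))

  lower : length ys ≤ length xs
  lower = subst (_≤ length xs) (length-map (punchIn v) ys)
                (maxG (map (punchIn v) ys) (legal-punchIn G v ys legal′))
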